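{- Let $G$ be a finite simple graph with minimum degree $\delta(G)\geq 1$, and let $M(G)$ be its Mycielskian. Then $\chi_d^t(G)+1 \leq \chi_d^t(M(G)) \leq \chi_d^t(G)+2$.
   Context: All graphs are finite, undirected and simple. A proper coloring of $G$ partitions $V(G)$ into nonempty color classes. A total dominator coloring (TDC) of $G$ is a proper coloring of $G$ in which every vertex of $G$ is adjacent to every vertex of some color class. The total dominator chromatic number $\chi_d^t(G)$ is the minimum number of color classes in a TDC of $G$. If $V(G)=\{v_1,\dots,v_n\}$, the Mycielskian $M(G)$ is the graph with vertex set $V(G)\cup\{u_1,\dots,u_n\}\cup\{w\}$ and edge set $E(G)\cup\{u_iv_j : v_iv_j\in E(G)\}\cup\{u_iw : 1\le i\le n\}$. -}

module Defs where

open import Data.Nat using (ℕ; suc; _+_; _≤_)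
open import Data.Fin using (Fin; zero; suc; splitAt)
open import Data.Sum using (_⊎_; inj₁; inj₂)
open import Data.Product using (Σ; ∃; _×_; _,_)
open import Data.Empty using (⊥)
open import Data.Unit using (⊤)
open import Relation.Nullary using (¬_)
open import Relation.Binary.PropositionalEquality using (_≡_; _≢_)
open import Level using (0ℓ)

record Graph : Set₁ where
  field
    n     : ℕ
    Adj   : Fin n → Fin n → Set
    irrefl : ∀ x → ¬ Adj x x
    sym   : ∀ {x y} → Adj x y → Adj y x

open Graph public

MinDegreeAtLeast1 : Graph → Set
MinDegreeAtLeast1 G = ∀ x → ∃ λ y → Adj G x y

-- Mycielskian.  Vertex set Fin (suc (n + n)):
--   index 0 is w, indices 1+i (i < n) are v_i, indices 1+n+i are u_i.
data MVert (n : ℕ) : Set where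
  w : MVert n
  v : Fin n → MVert n
  u : Fin n → MVert n

classify : ∀ {n} → Fin (suc (n + n)) → MVert n
classify zero = w
classify {n} (suc i) with splitAt n i
... | inj₁ j = v j
... | inj₂ j = u j

MAdjV : ∀ {n} → (Fin n → Fin n → Set) → MVert n → MVert n → Set
MAdjV A w w = ⊥
MAdjV A w (v _) = ⊥
MAdjV A w (u _) = ⊤
MAdjV A (v _) w = ⊥
MAdjV A (v i) (v j) = A i j
MAdjV A (v i) (u j) = A j i
MAdjV A (u _) w = ⊤
MAdjV A (u i) (v j) = A i j
MAdjV A (u _) (u _) = ⊥

private
  MAdjV-irrefl : ∀ {n} (A : Fin n → Fin n → Set) → (∀ x → ¬ A x x) → ∀ x → ¬ MAdjV A x x
  MAdjV-irrefl A ir w ()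
  MAdjV-irrefl A ir (v i) = ir i
  MAdjV-irrefl A ir (u i) ()

  MAdjV-sym : ∀ {n} (A : Fin n → Fin n → Set) → (∀ {x y} → A x y → A y x) →
              ∀ x y → MAdjV A x y → MAdjV A y x
  MAdjV-sym A s w (u _) p = p
  MAdjV-sym A s (v i) (v j) p = s p
  MAdjV-sym A s (v i) (u j) p = p
  MAdjV-sym A s (u _) w p = p
  MAdjV-sym A s (u i) (v j) p = p

Mycielskian : Graph → Graph
Mycielskian G = record
  { n = suc (n G + n G)
  ; Adj = λ x y → MAdjV (Adj G) (classify x) (classify y)
  ; irrefl = λ x → MAdjV-irrefl (Adj G) (irrefl G) (classify x)
  ; sym = λ {x} {y} → MAdjV-sym (Adj G) (sym G) (classify x) (classify y)
  }

record Coloring (G : Graph) (k : ℕ) : Set where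
  field
    col     : Fin (n G) → Fin k
    proper  : ∀ x y → Adj G x y → col x ≢ col y
    onto    : ∀ (c : Fin k) → ∃ λ x → col x ≡ c

IsTDC : (G : Graph) {k : ℕ} → Coloring G k → Set
IsTDC G {k} C = ∀ x → ∃ λ (c : Fin k) → ∀ y → Coloring.col C y ≡ c → Adj G x y

HasTDC : Graph → ℕ → Set
HasTDC G k = Σ (Coloring G k) (IsTDC G)

IsTDChromaticNumber : Graph → ℕ → Set
IsTDChromaticNumber G k = HasTDC G k × (∀ k' → HasTDC G k' → k ≤ k')

-- A TDC of G with a colours yields one of M(G) with a + 2: give w and the
-- u-vertices one new colour each and let u_i copy the dominated class of v_i.
-- Conversely, a TDC of M(G) with b colours yields a colouring of G with at most
-- b − 1 colours in which every vertex dominates a nonempty class; dropping the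
-- empty classes gives a TDC of G.  If some v_j has the colour α of w, restrict
-- to the v-vertices: u_i and v_i have the same neighbours in G, so the class
-- dominated by u_i serves v_i, and the class dominated by w contains no v_j.
-- Otherwise recolour, for each colour c used by no v-vertex, one vertex v_j with
-- c = colour (u_j); then α is unused, since every u_j is adjacent to w.
module Submission where

open import Defs hiding (sym)
open import Data.Nat using (ℕ; _+_; _≤_)
open import Data.Product using (_×_)

open import Data.Nat using (suc; _<_; s≤s)
open import Data.Nat.Properties using (≤-refl; ≤-trans; m≤n⇒m≤1+n; +-comm)
open import Data.Fin as Fin using (Fin; join; splitAt; punchOut; _≟_)
open import Data.Fin.Properties
  using (splitAt-join; join-splitAt; punchOut-injective; suc-injective; all?; any?; ¬∀⟶∃¬)
open import Data.Sum using (_⊎_; inj₁; inj₂)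
open import Data.Product using (∃; _,_; proj₁; proj₂)
open import Data.Empty using (⊥-elim)
open import Data.Unit using (tt)
open import Function using (_∘_)
open import Relation.Nullary using (¬_; Dec; yes; no; ¬?)
open import Relation.Nullary.Decidable using (map′; _×-dec_)
open import Relation.Binary.Definitions using (DecidableEquality)
open import Relation.Binary.PropositionalEquality
  using (_≡_; _≢_; refl; sym; trans; cong; subst; subst₂)

DominatesNonemptyClass : (G : Graph) {m : ℕ} → (Fin (n G) → Fin m) → Fin (n G) → Set
DominatesNonemptyClass G col x = ∃ λ c → (∃ λ y → col y ≡ c) × (∀ y → col y ≡ c → Adj G x y)

record WeakTDC (G : Graph) (m : ℕ) : Set where
  field
    col       : Fin (n G) → Fin m
    proper    : ∀ x y → Adj G x y → col x ≢ col y
    dominated : ∀ x → DominatesNonemptyClass G col x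

module _ {G : Graph} where
  open WeakTDC

  removeUnusedColor : ∀ {m} (W : WeakTDC G (suc m)) (e : Fin (suc m)) →
                      (∀ x → e ≢ col W x) → WeakTDC G m
  removeUnusedColor {m} W e unused = record
    { col       = col′
    ; proper    = λ x y a eq → proper W x y a (punchOut-injective (unused x) (unused y) eq)
    ; dominated = dominated′
    }
    where
    col′ : Fin (n G) → Fin m
    col′ x = punchOut (unused x)

    dominated′ : ∀ x → DominatesNonemptyClass G col′ x
    dominated′ x with dominated W x
    ... | c , (y , cy) , h =
      col′ y , (y , refl) , λ z eq → h z (trans (punchOut-injective (unused z) (unused y) eq) cy)

  weakTDC⇒TDC : ∀ m → WeakTDC G m → ∃ λ k → k ≤ m × HasTDC G k
  weakTDC⇒TDC m W with all? (λ c → any? (λ x → col W x ≟ c))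
  ... | yes onto = m , ≤-refl , record { col = col W ; proper = proper W ; onto = onto } ,
                   λ x → let (c , _ , h) = dominated W x in c , h
  ... | no notOnto with ¬∀⟶∃¬ m _ (λ c → any? (λ x → col W x ≟ c)) notOnto
  weakTDC⇒TDC (suc m) W | no _ | e , unused
    with weakTDC⇒TDC m (removeUnusedColor W e (λ x eq → unused (x , sym eq)))
  ... | k , k≤m , T = k , m≤n⇒m≤1+n k≤m , T

  weakTDC-unused⇒TDC : ∀ m (W : WeakTDC G m) (e : Fin m) → (∀ x → e ≢ col W x) →
                       ∃ λ k → k < m × HasTDC G k
  weakTDC-unused⇒TDC (suc m) W e unused with weakTDC⇒TDC m (removeUnusedColor W e unused)
  ... | k , k≤m , T = k , s≤s k≤m , T

module _ {n : ℕ} where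
  embed : MVert n → Fin (suc (n + n))
  embed w     = Fin.zero
  embed (v j) = Fin.suc (join n n (inj₁ j))
  embed (u j) = Fin.suc (join n n (inj₂ j))

  classify-embed : ∀ p → classify (embed p) ≡ p
  classify-embed w = refl
  classify-embed (v j) rewrite splitAt-join n n (inj₁ j) = refl
  classify-embed (u j) rewrite splitAt-join n n (inj₂ j) = refl

  embed-classify : ∀ i → embed (classify i) ≡ i
  embed-classify Fin.zero = refl
  embed-classify (Fin.suc i) with splitAt n i in eq
  ... | inj₁ _ = cong Fin.suc (trans (cong (join n n) (sym eq)) (join-splitAt n n i))
  ... | inj₂ _ = cong Fin.suc (trans (cong (join n n) (sym eq)) (join-splitAt n n i))

  embed-injective : ∀ {p q} → embed p ≡ embed q → p ≡ q
  embed-injective {p} {q} eq =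
    trans (sym (classify-embed p)) (trans (cong classify eq) (classify-embed q))

  _≟ᴹ_ : DecidableEquality (MVert n)
  p ≟ᴹ q = map′ embed-injective (cong embed) (embed p ≟ embed q)

  u-injective : ∀ {i j} → MVert.u {n} i ≡ u j → i ≡ j
  u-injective refl = refl

record MycielskiTDC (G : Graph) (b : ℕ) : Set where
  field
    col       : MVert (n G) → Fin b
    proper    : ∀ p q → MAdjV (Adj G) p q → col p ≢ col q
    onto      : ∀ c → ∃ λ p → col p ≡ c
    dominated : ∀ p → ∃ λ c → ∀ q → col q ≡ c → MAdjV (Adj G) p q

toMycielskiTDC : ∀ {G b} → HasTDC (Mycielskian G) b → MycielskiTDC G b
toMycielskiTDC {G} (C , isTDC) = record
  { col       = col ∘ embed
  ; proper    = λ p q a → proper (embed p) (embed q) (adj-embed {p} {q} a)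
  ; onto      = λ c → let (i , e) = onto c in classify i , trans (cong col (embed-classify i)) e
  ; dominated = λ p → let (c , h) = isTDC (embed p) in
                      c , λ q e → subst₂ (MAdjV (Adj G)) (classify-embed p) (classify-embed q) (h (embed q) e)
  }
  where
  open Coloring C
  adj-embed : ∀ {p q} → MAdjV (Adj G) p q → Adj (Mycielskian G) (embed p) (embed q)
  adj-embed {p} {q} = subst₂ (MAdjV (Adj G)) (sym (classify-embed p)) (sym (classify-embed q))

fromMycielskiTDC : ∀ {G b} → MycielskiTDC G b → HasTDC (Mycielskian G) b
fromMycielskiTDC T =
  record
    { col    = col ∘ classify
    ; proper = λ x y → proper (classify x) (classify y)
    ; onto   = λ c → let (p , e) = onto c in embed p , trans (cong col (classify-embed p)) e
    } ,
  λ x → let (c , h) = dominated (classify x) in c , λ y → h (classify y)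
  where open MycielskiTDC T

mycielskian-vertex : ∀ {G b} → MycielskiTDC G b → Fin (n G)
mycielskian-vertex {G} {b} T = u-vertex (onto β)
  where
  open MycielskiTDC T
  β : Fin b
  β = proj₁ (dominated w)

  u-vertex : (∃ λ p → col p ≡ β) → Fin (n G)
  u-vertex (w   , e) = ⊥-elim (proj₂ (dominated w) w e)
  u-vertex (v j , e) = ⊥-elim (proj₂ (dominated w) (v j) e)
  u-vertex (u j , _) = j

TDC⇒MycielskiTDC : ∀ {G a} → HasTDC G a → Fin (n G) → MycielskiTDC G (suc (suc a))
TDC⇒MycielskiTDC {G} {a} (C , isTDC) j₀ = record
  { col       = colᴹ
  ; proper    = properᴹ
  ; onto      = ontoᴹ
  ; dominated = dominatedᴹ
  }
  where
  open Coloring C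
  colᴹ : MVert (n G) → Fin (suc (suc a))
  colᴹ w     = Fin.zero
  colᴹ (u _) = Fin.suc Fin.zero
  colᴹ (v i) = Fin.suc (Fin.suc (col i))

  properᴹ : ∀ p q → MAdjV (Adj G) p q → colᴹ p ≢ colᴹ q
  properᴹ w     (u _) _ ()
  properᴹ (v i) (v j) a e = proper i j a (suc-injective (suc-injective e))
  properᴹ (v _) (u _) _ ()
  properᴹ (u _) w     _ ()
  properᴹ (u _) (v _) _ ()

  ontoᴹ : ∀ c → ∃ λ p → colᴹ p ≡ c
  ontoᴹ Fin.zero                = w , refl
  ontoᴹ (Fin.suc Fin.zero)      = u j₀ , refl
  ontoᴹ (Fin.suc (Fin.suc c)) = let (i , e) = onto c in v i , cong (Fin.suc ∘ Fin.suc) e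

  dominatedᴹ : ∀ p → ∃ λ c → ∀ q → colᴹ q ≡ c → MAdjV (Adj G) p q
  dominatedᴹ w     = Fin.suc Fin.zero , λ { w () ; (v _) () ; (u _) _ → tt }
  dominatedᴹ (v i) = let (c , h) = isTDC i in
    Fin.suc (Fin.suc c) , λ { w () ; (u _) () ; (v j) e → h j (suc-injective (suc-injective e)) }
  dominatedᴹ (u i) = let (c , h) = isTDC i in
    Fin.suc (Fin.suc c) , λ { w () ; (u _) () ; (v j) e → h j (suc-injective (suc-injective e)) }

module MycielskiTDC⇒TDC {G : Graph} {b : ℕ} (T : MycielskiTDC G b) where
  open MycielskiTDC T

  α : Fin b
  α = col w

  w-class-avoids-v : ∀ j → proj₁ (dominated w) ≢ col (v j)
  w-class-avoids-v j eq = proj₂ (dominated w) (v j) (sym eq)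

  restrictionToV : ∀ j₀ → col (v j₀) ≡ α → WeakTDC G b
  restrictionToV j₀ v-has-α = record
    { col       = col ∘ v
    ; proper    = λ x y → proper (v x) (v y)
    ; dominated = dominatedᵛ
    }
    where
    dominatedᵛ : ∀ i → DominatesNonemptyClass G (col ∘ v) i
    dominatedᵛ i with dominated (u i)
    ... | d , hd with d ≟ α
    ...   | yes refl = α , (j₀ , v-has-α) , λ j → hd (v j)
    ...   | no d≢α = from-v (onto d)
      where
      from-v : (∃ λ p → col p ≡ d) → DominatesNonemptyClass G (col ∘ v) i
      from-v (w   , e) = ⊥-elim (d≢α (sym e))
      from-v (v j , e) = d , (j , e) , λ y → hd (v y)
      from-v (u j , e) = ⊥-elim (hd (u j) e)

  module Recoloring (v-avoids-α : ∀ j → col (v j) ≢ α) where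
    AbsentOnV : Fin b → Set
    AbsentOnV c = ∀ j → col (v j) ≢ c

    rep : Fin b → MVert (n G)
    rep c = proj₁ (onto c)

    IsRep : Fin (n G) → Set
    IsRep j = AbsentOnV (col (u j)) × rep (col (u j)) ≡ u j

    isRep? : ∀ j → Dec (IsRep j)
    isRep? j = all? (λ k → ¬? (col (v k) ≟ col (u j))) ×-dec (rep (col (u j)) ≟ᴹ u j)

    recolor : ∀ j → Dec (IsRep j) → Fin b
    recolor j (yes _) = col (u j)
    recolor j (no _)  = col (v j)

    col′ : Fin (n G) → Fin b
    col′ j = recolor j (isRep? j)

    col′-cases : ∀ j → (IsRep j × col′ j ≡ col (u j)) ⊎ (¬ IsRep j × col′ j ≡ col (v j))
    col′-cases j with isRep? j
    ... | yes r  = inj₁ (r , refl)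
    ... | no ¬r  = inj₂ (¬r , refl)

    rep-unique : ∀ {j k} → IsRep j → IsRep k → col (u j) ≡ col (u k) → j ≡ k
    rep-unique (_ , rj) (_ , rk) eq = u-injective (trans (sym rj) (trans (cong rep eq) rk))

    proper′ : ∀ j k → Adj G j k → col′ j ≢ col′ k
    proper′ j k a eq with col′-cases j | col′-cases k
    ... | inj₁ (rj , cj) | inj₁ (rk , ck) =
      irrefl G j (subst (Adj G j) (sym (rep-unique rj rk (trans (sym cj) (trans eq ck)))) a)
    ... | inj₁ (rj , cj) | inj₂ (_ , ck)  = proj₁ rj k (trans (sym ck) (trans (sym eq) cj))
    ... | inj₂ (_ , cj)  | inj₁ (rk , ck) = proj₁ rk j (trans (sym cj) (trans eq ck))
    ... | inj₂ (_ , cj)  | inj₂ (_ , ck)  = proper (v j) (v k) a (trans (sym cj) (trans eq ck))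

    dominates-recolored : ∀ i c → (∀ q → col q ≡ c → MAdjV (Adj G) (v i) q) →
                          ∀ j → col′ j ≡ c → Adj G i j
    dominates-recolored i c hc j e with col′-cases j
    ... | inj₁ (_ , cj) = Graph.sym G (hc (u j) (trans (sym cj) e))
    ... | inj₂ (_ , cj) = hc (v j) (trans (sym cj) e)

    dominated′ : ∀ i → DominatesNonemptyClass G col′ i
    dominated′ i with dominated (v i)
    ... | c , hc with any? (λ k → col (v k) ≟ c)
    ...   | yes (k , ck) with col′-cases k
    ...     | inj₂ (_ , c′k) = c , (k , trans c′k ck) , dominates-recolored i c hc
    ...     | inj₁ (rk , c′k) = col (u k) , (k , c′k) , singleton
      where
      singleton : ∀ y → col′ y ≡ col (u k) → Adj G i y
      singleton y e with col′-cases y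
      ... | inj₁ (ry , c′y) = subst (Adj G i) (sym (rep-unique ry rk (trans (sym c′y) e))) (hc (v k) ck)
      ... | inj₂ (_ , c′y)  = ⊥-elim (proj₁ rk y (trans (sym c′y) e))
    dominated′ i | c , hc | no none = from-rep (rep c) refl (proj₂ (onto c))
      where
      from-rep : ∀ p → rep c ≡ p → col p ≡ c → DominatesNonemptyClass G col′ i
      from-rep w     _  e = ⊥-elim (hc w e)
      from-rep (v m) _  e = ⊥-elim (none (m , e))
      from-rep (u k) rp e with col′-cases k
      ... | inj₁ (_ , c′k) = c , (k , trans c′k e) , dominates-recolored i c hc
      ... | inj₂ (¬rk , _) = ⊥-elim (¬rk ((λ m e′ → none (m , trans e′ e)) , trans (cong rep e) rp))

    recoloring : WeakTDC G b
    recoloring = record { col = col′ ; proper = proper′ ; dominated = dominated′ }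

    α-unused : ∀ j → α ≢ col′ j
    α-unused j eq with col′-cases j
    ... | inj₁ (_ , cj) = proper (u j) w tt (trans (sym cj) (sym eq))
    ... | inj₂ (_ , cj) = v-avoids-α j (trans (sym cj) (sym eq))

  smallerTDC : ∃ λ k → k < b × HasTDC G k
  smallerTDC with any? (λ j → col (v j) ≟ α)
  ... | yes (j₀ , v-has-α) =
    weakTDC-unused⇒TDC b (restrictionToV j₀ v-has-α) (proj₁ (dominated w)) w-class-avoids-v
  ... | no none = weakTDC-unused⇒TDC b recoloring α α-unused
    where open Recoloring (λ j e → none (j , e))

theorem2p1 : (G : Graph) → MinDegreeAtLeast1 G →
    (a b : ℕ) → IsTDChromaticNumber G a → IsTDChromaticNumber (Mycielskian G) b →
    (a + 1 ≤ b) × (b ≤ a + 2)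
theorem2p1 G _ a b (Tᴳ , minimal-a) (Tᴹ , minimal-b)
  with MycielskiTDC⇒TDC.smallerTDC (toMycielskiTDC Tᴹ)
... | k , k<b , Tₖ =
  subst (_≤ b) (+-comm 1 a) (≤-trans (s≤s (minimal-a k Tₖ)) k<b) ,
  subst (b ≤_) (+-comm 2 a) (minimal-b (2 + a) (fromMycielskiTDC upper))
  where
  upper : MycielskiTDC G (2 + a)
  upper = TDC⇒MycielskiTDC Tᴳ (mycielskian-vertex (toMycielskiTDC {G} Tᴹ))
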